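{- Let $r\ge2$ and let $A\subseteq\mathbb{Z}/r\mathbb{Z}$ be nonempty. Let $J_+,J_-\subseteq\mathbb{Z}/r\mathbb{Z}$. Then the set of statements $\Gamma_0=\{P_w\}_{w\in J_+}\sqcup\{\lnot P_{w_0}\}_{w_0\in J_- }$ is consistent if and only if for all $w_0\in J_-$, $A+w_0\not\subseteq\bigcup_{w\in J_+}(A+w)$.
   Context: For $w\in\mathbb{Z}/r\mathbb{Z}$, $A+w=\{a+w\mid a\in A\}$. For a valuation $V\subseteq\mathbb{Z}/r\mathbb{Z}$, the proposition $P_w$ is true iff $A+w\subseteq V$, and $\lnot P_w$ is true iff $P_w$ is false. A set of such propositions is consistent if there exists a valuation $V\subseteq\mathbb{Z}/r\mathbb{Z}$ making all of them true. -}

module Defs where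

open import Data.Nat using (ℕ; suc; NonZero)
open import Data.Nat.DivMod using (_mod_)
open import Data.Fin using (Fin; toℕ)
open import Data.Fin.Subset using (Subset; _∈_; _⊆_)
open import Data.Product using (Σ; ∃; _×_)
open import Data.List using (List)
open import Relation.Binary.PropositionalEquality using (_≡_)
open import Relation.Nullary using (¬_)
import Data.Nat as ℕ

_+ᵣ_ : ∀ {r} .{{_ : NonZero r}} → Fin r → Fin r → Fin r
_+ᵣ_ {r} x y = (toℕ x ℕ.+ toℕ y) mod r

_∈Shift_by_ : ∀ {r} .{{_ : NonZero r}} → Fin r → Subset r → Fin r → Set
x ∈Shift A by w = ∃ λ a → a ∈ A × x ≡ a +ᵣ w

ShiftSub : ∀ {r} .{{_ : NonZero r}} → Subset r → Fin r → Subset r → Set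
ShiftSub A w V = ∀ x → x ∈Shift A by w → x ∈ V

-- P_w holds in valuation V  iff  A + w ⊆ V
P : ∀ {r} .{{_ : NonZero r}} → Subset r → Fin r → Subset r → Set
P A w V = ShiftSub A w V

Consistent : ∀ {r} .{{_ : NonZero r}} → Subset r → Subset r → Subset r → Set
Consistent A J₊ J₋ = ∃ λ (V : Subset _) → (∀ w → w ∈ J₊ → P A w V) × (∀ w₀ → w₀ ∈ J₋ → ¬ P A w₀ V)

ShiftInUnion : ∀ {r} .{{_ : NonZero r}} → Subset r → Fin r → Subset r → Set
ShiftInUnion A w₀ J₊ = ∀ x → x ∈Shift A by w₀ → ∃ λ w → w ∈ J₊ × x ∈Shift A by w

-- The union U of the translates A + w, w ∈ J₊, is the least valuation satisfying every P_w
-- with w ∈ J₊. Since each P_w₀ is monotone in the valuation, Γ₀ is consistent iff U itself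
-- refutes every P_w₀ with w₀ ∈ J₋, and U ⊨ P_w₀ says precisely that A + w₀ ⊆ U.
module Submission where

open import Defs
open import Data.Nat using (ℕ; NonZero; _≥_)
open import Data.Fin using (Fin)
open import Data.Fin.Subset using (Subset; _∈_; _⊆_; Nonempty)
open import Data.Fin.Subset.Properties using (_∈?_)
open import Data.Fin.Properties using (any?) renaming (_≟_ to _≟ᶠ_)
open import Data.Product using (_×_; _,_; ∃)
open import Data.Vec using (tabulate)
open import Data.Vec.Properties using (lookup∘tabulate; lookup⇒[]=; []=⇒lookup)
open import Relation.Nullary using (¬_; Dec; does; yes; no)
open import Relation.Nullary.Decidable using (dec-true; _×-dec_)
open import Relation.Unary using (Pred; Decidable)
open import Relation.Binary.PropositionalEquality using (trans; sym)
open import Function.Bundles using (Equivalence; _⇔_; mk⇔)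
open import Level using (0ℓ)

module _ {n : ℕ} {Q : Pred (Fin n) 0ℓ} (Q? : Decidable Q) where

  fromDecidable : Subset n
  fromDecidable = tabulate (λ x → does (Q? x))

  ∈-fromDecidable⁺ : ∀ {x} → Q x → x ∈ fromDecidable
  ∈-fromDecidable⁺ {x} q =
    lookup⇒[]= x fromDecidable (trans (lookup∘tabulate _ x) (dec-true (Q? x) q))

  ∈-fromDecidable⁻ : ∀ {x} → x ∈ fromDecidable → Q x
  ∈-fromDecidable⁻ {x} x∈ with Q? x | trans (sym (lookup∘tabulate _ x)) ([]=⇒lookup x∈)
  ... | yes q | _  = q
  ... | no _  | ()

module _ {r : ℕ} .{{_ : NonZero r}} (A : Subset r) where

  InShiftUnion : Subset r → Pred (Fin r) 0ℓ
  InShiftUnion J x = ∃ λ w → w ∈ J × x ∈Shift A by w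

  _∈Shift?_ : ∀ x w → Dec (x ∈Shift A by w)
  x ∈Shift? w = any? (λ a → (a ∈? A) ×-dec (x ≟ᶠ (a +ᵣ w)))

  InShiftUnion? : ∀ J → Decidable (InShiftUnion J)
  InShiftUnion? J x = any? (λ w → (w ∈? J) ×-dec (x ∈Shift? w))

  shiftUnion : Subset r → Subset r
  shiftUnion J = fromDecidable (InShiftUnion? J)

  P-mono : ∀ {w V V′} → V ⊆ V′ → P A w V → P A w V′
  P-mono V⊆V′ p x x∈ = V⊆V′ (p x x∈)

  P-shiftUnion : ∀ J {w} → w ∈ J → P A w (shiftUnion J)
  P-shiftUnion J w∈J x x∈ = ∈-fromDecidable⁺ (InShiftUnion? J) (_ , w∈J , x∈)

  shiftUnion-least : ∀ J {V} → (∀ w → w ∈ J → P A w V) → shiftUnion J ⊆ V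
  shiftUnion-least J pos x∈ with ∈-fromDecidable⁻ (InShiftUnion? J) x∈
  ... | w , w∈J , x∈A+w = pos w w∈J _ x∈A+w

  ShiftInUnion⇔P-shiftUnion : ∀ J w₀ → ShiftInUnion A w₀ J ⇔ P A w₀ (shiftUnion J)
  ShiftInUnion⇔P-shiftUnion J w₀ = mk⇔
    (λ covered x x∈ → ∈-fromDecidable⁺ (InShiftUnion? J) (covered x x∈))
    (λ p x x∈ → ∈-fromDecidable⁻ (InShiftUnion? J) (p x x∈))

proposition1 : (r : ℕ) → .{{_ : NonZero r}} → r ≥ 2 → (A J₊ J₋ : Subset r) → Nonempty A
    → (Consistent A J₊ J₋ → (∀ w₀ → w₀ ∈ J₋ → ¬ ShiftInUnion A w₀ J₊))
    × ((∀ w₀ → w₀ ∈ J₋ → ¬ ShiftInUnion A w₀ J₊) → Consistent A J₊ J₋)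
proposition1 r _ A J₊ J₋ _ = consistent⇒separated , separated⇒consistent
  where
  open Equivalence

  consistent⇒separated : Consistent A J₊ J₋ → ∀ w₀ → w₀ ∈ J₋ → ¬ ShiftInUnion A w₀ J₊
  consistent⇒separated (V , pos , neg) w₀ w₀∈J₋ covered = neg w₀ w₀∈J₋
    (P-mono A (shiftUnion-least A J₊ pos) (to (ShiftInUnion⇔P-shiftUnion A J₊ w₀) covered))

  separated⇒consistent : (∀ w₀ → w₀ ∈ J₋ → ¬ ShiftInUnion A w₀ J₊) → Consistent A J₊ J₋
  separated⇒consistent sep = shiftUnion A J₊
    , (λ w → P-shiftUnion A J₊)
    , (λ w₀ w₀∈J₋ p → sep w₀ w₀∈J₋ (from (ShiftInUnion⇔P-shiftUnion A J₊ w₀) p))
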